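{- Let $A$ be an srl-monoid and $S\subseteq A^{ - }$. Then \[ \mathsf{C}[S] = \{x\in A: \square^{n}(h) \leq x \text{ and } x\cdot \square^{n}(h) \leq e \text{ for some } h\in \langle S\rangle \text{ and } n\in \mathbb{N}\}. \]
   Context: A commutative l-monoid is an algebra $(A,\wedge,\vee,\cdot,e)$ of type $(2,2,2,0)$ such that $(A,\wedge,\vee)$ is a lattice, $(A,\cdot,e)$ is a commutative monoid and $(a\vee b)\cdot c=(a\cdot c)\vee(b\cdot c)$ for all $a,b,c\in A$. An algebra $(A,\wedge,\vee,\cdot,\rightarrow,e)$ of type $(2,2,2,2,0)$ is an srl-monoid if $(A,\wedge,\vee,\cdot,e)$ is a commutative l-monoid and there is a subalgebra $Q$ of $(A,\wedge,\vee,\cdot,e)$ such that for all $a,b\in A$ the set $\{q\in Q: a\cdot q\leq b\}$ has a maximum and $a\rightarrow b$ equals this maximum. $A^{ - }=\{a\in A: a\le e\}$. $\square(a)=e\rightarrow a$; $\square^0(a)=a$, $\square^1(a)=\square(a)$ and $\square^{n+1}(a)=\square(a)\cdot\square^n(a)$ for $n\ge1$. $\mathbb{N}=\{0,1,2,\dots\}$. $\langle S\rangle$ is the submonoid of $(A,\cdot,e)$ generated by $S$. A convex subalgebra is a subalgebra $H$ of $(A,\wedge,\vee,\cdot,\rightarrow,e)$ such that $a,b\in H$, $a\le c\le b$ imply $c\in H$; it is strongly convex if for all $a\in A$, $h\in H$ with $a\cdot h\le e\le h\rightarrow a$ one has $a\in H$. $\mathsf{C}[S]$ is the smallest strongly convex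 subalgebra of $A$ containing $S$. -}

module Defs where

open import Level using (0ℓ)
open import Data.Nat using (ℕ; zero; suc)
open import Data.Product using (_×_; Σ; ∃; _,_)
open import Relation.Binary.PropositionalEquality using (_≡_)
open import Algebra.Core using (Op₂)
open import Algebra.Lattice.Structures using (IsLattice)
import Algebra.Structures as AS

-- The subalgebra Q of the l-monoid
-- reduct witnessing the residuation condition is part of the data.
record SRLMonoid : Set₁ where
  infixr 6 _∨_
  infixr 7 _∧_
  infixl 8 _·_
  infixr 5 _⇒_
  infix 4 _≤_
  field
    Carrier : Set
    _∧_ _∨_ _·_ _⇒_ : Op₂ Carrier
    e : Carrier
    isLattice : IsLattice _≡_ _∨_ _∧_
    isCommutativeMonoid : AS.IsCommutativeMonoid _≡_ _·_ e
    distrib : ∀ a b c → (a ∨ b) · c ≡ (a · c) ∨ (b · c)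

  _≤_ : Carrier → Carrier → Set
  a ≤ b = a ∧ b ≡ a

  field
    Q : Carrier → Set
    Q-∧ : ∀ {a b} → Q a → Q b → Q (a ∧ b)
    Q-∨ : ∀ {a b} → Q a → Q b → Q (a ∨ b)
    Q-· : ∀ {a b} → Q a → Q b → Q (a · b)
    Q-e : Q e
    ⇒-Q   : ∀ a b → Q (a ⇒ b)
    ⇒-le  : ∀ a b → a · (a ⇒ b) ≤ b
    ⇒-max : ∀ a b q → Q q → a · q ≤ b → q ≤ a ⇒ b

module _ (A : SRLMonoid) where
  open SRLMonoid A

  Pred : Set₁
  Pred = Carrier → Set

  _⊆_ : Pred → Pred → Set
  P ⊆ R = ∀ x → P x → R x

  Neg : Pred
  Neg a = a ≤ e

  □ : Carrier → Carrier
  □ a = e ⇒ a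

  □^ : ℕ → Carrier → Carrier
  □^ zero a = a
  □^ (suc zero) a = □ a
  □^ (suc (suc n)) a = □ a · □^ (suc n) a

  data ⟨_⟩ (S : Pred) : Pred where
    gen  : ∀ {s} → S s → ⟨ S ⟩ s
    unit : ⟨ S ⟩ e
    mul  : ∀ {a b} → ⟨ S ⟩ a → ⟨ S ⟩ b → ⟨ S ⟩ (a · b)

  record IsSubalgebra (H : Pred) : Set where
    field
      ∧-closed : ∀ {a b} → H a → H b → H (a ∧ b)
      ∨-closed : ∀ {a b} → H a → H b → H (a ∨ b)
      ·-closed : ∀ {a b} → H a → H b → H (a · b)
      ⇒-closed : ∀ {a b} → H a → H b → H (a ⇒ b)
      e-closed : H e

  record IsConvexSubalgebra (H : Pred) : Set where
    field
      isSubalgebra : IsSubalgebra H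
      convex : ∀ {a b c} → H a → H b → a ≤ c → c ≤ b → H c

  record IsStronglyConvexSubalgebra (H : Pred) : Set where
    field
      isConvexSubalgebra : IsConvexSubalgebra H
      strongly : ∀ {a h} → H h → a · h ≤ e → e ≤ h ⇒ a → H a

  C[_] : Pred → Carrier → Set₁
  C[ S ] x = ∀ (H : Pred) → IsStronglyConvexSubalgebra H → S ⊆ H → H x

{-# OPTIONS --safe #-}
-- Call k a bound of x when k ≤ x and x · k ≤ e.  Such bounds can be shrunk
-- freely; two elements with a common bound k have k as a bound of their
-- meet, join and everything between them, and k · k as a bound of their
-- product and (when k ∈ Q) of their residual.  The box powers of elements
-- of ⟨ S ⟩ ⊆ A⁻ form a downward directed family closed under squaring, so the
-- elements with such a bound form a strongly convex subalgebra containing S.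
-- Conversely a strongly convex subalgebra H ⊇ S contains every box power k,
-- and if k bounds x then x · k ≤ e ≤ k ⇒ x, whence x ∈ H.
module Submission where

open import Defs
open import Level using (0ℓ)
open import Data.Nat using (ℕ; suc; zero; _+_; _≤′_; ≤′-refl; ≤′-step)
  renaming (_≤_ to _≤ℕ_)
open import Data.Nat.Properties using (≤⇒≤′; m≤m+n; m≤n+m; m≤n⇒m≤1+n)
open import Data.Product using (_×_; Σ; _,_)
open import Function.Bundles using (_⇔_; mk⇔)
open import Relation.Binary.PropositionalEquality
  using (_≡_; refl; sym; trans; cong; subst; subst₂; isEquivalence)
open import Relation.Binary.Structures using (IsPartialOrder)
open import Relation.Binary.Bundles using (Poset)
open import Algebra.Lattice.Properties.Lattice using (∨-∧-orderTheoreticLattice)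
import Relation.Binary.Lattice as OrderTheoretic
import Relation.Binary.Lattice.Properties.JoinSemilattice as JoinSemilatticeProperties
import Relation.Binary.Reasoning.PartialOrder as PartialOrderReasoning
import Algebra.Structures as AS

module _ (A : SRLMonoid) where
  open SRLMonoid A
  open AS.IsCommutativeMonoid isCommutativeMonoid using (assoc; comm; identityˡ; identityʳ)

  private
    orderLattice : OrderTheoretic.Lattice 0ℓ 0ℓ 0ℓ
    orderLattice = ∨-∧-orderTheoreticLattice (record { isLattice = isLattice })

    module L = OrderTheoretic.Lattice orderLattice
    module J = JoinSemilatticeProperties L.joinSemilattice

  -- The library's natural order is  a ≡ a ∧ b , the symmetric form of  _≤_ .
  ≤-refl : ∀ {a} → a ≤ a
  ≤-refl = sym L.refl

  ≤-reflexive : ∀ {a b} → a ≡ b → a ≤ b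
  ≤-reflexive refl = ≤-refl

  ≤-trans : ∀ {a b c} → a ≤ b → b ≤ c → a ≤ c
  ≤-trans p q = sym (L.trans (sym p) (sym q))

  x∧y≤x : ∀ x y → x ∧ y ≤ x
  x∧y≤x x y = sym (L.x∧y≤x x y)

  ∧-greatest : ∀ {x y z} → x ≤ y → x ≤ z → x ≤ y ∧ z
  ∧-greatest p q = sym (L.∧-greatest (sym p) (sym q))

  x≤x∨y : ∀ x y → x ≤ x ∨ y
  x≤x∨y x y = sym (L.x≤x∨y x y)

  ∨-least : ∀ {x y z} → x ≤ z → y ≤ z → x ∨ y ≤ z
  ∨-least p q = sym (L.∨-least (sym p) (sym q))

  x≤y⇒x∨y≡y : ∀ {x y} → x ≤ y → x ∨ y ≡ y
  x≤y⇒x∨y≡y p = J.x≤y⇒x∨y≈y (sym p)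

  ≤-antisym : ∀ {a b} → a ≤ b → b ≤ a → a ≡ b
  ≤-antisym p q = L.antisym (sym p) (sym q)

  ≤-isPartialOrder : IsPartialOrder _≡_ _≤_
  ≤-isPartialOrder = record
    { isPreorder = record { isEquivalence = isEquivalence ; reflexive = ≤-reflexive ; trans = ≤-trans }
    ; antisym    = ≤-antisym
    }

  ≤-poset : Poset 0ℓ 0ℓ 0ℓ
  ≤-poset = record { isPartialOrder = ≤-isPartialOrder }

  module ≤-Reasoning = PartialOrderReasoning ≤-poset

  ·-monoˡ-≤ : ∀ c {a b} → a ≤ b → a · c ≤ b · c
  ·-monoˡ-≤ c {a} {b} p =
    subst (a · c ≤_) (trans (sym (distrib a b c)) (cong (_· c) (x≤y⇒x∨y≡y p))) (x≤x∨y _ _)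

  ·-monoʳ-≤ : ∀ c {a b} → a ≤ b → c · a ≤ c · b
  ·-monoʳ-≤ c {a} {b} p = subst₂ _≤_ (comm a c) (comm b c) (·-monoˡ-≤ c p)

  ·-mono-≤ : ∀ {a b c d} → a ≤ b → c ≤ d → a · c ≤ b · d
  ·-mono-≤ {b = b} {c} p q = ≤-trans (·-monoˡ-≤ c p) (·-monoʳ-≤ b q)

  x·y≤x : ∀ x {y} → y ≤ e → x · y ≤ x
  x·y≤x x y≤e = ≤-trans (·-monoʳ-≤ x y≤e) (≤-reflexive (identityʳ x))

  x·y≤y : ∀ {x} y → x ≤ e → x · y ≤ y
  x·y≤y y x≤e = ≤-trans (·-monoˡ-≤ y x≤e) (≤-reflexive (identityˡ y))

  ·-neg : ∀ {x y} → x ≤ e → y ≤ e → x · y ≤ e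
  ·-neg {y = y} x≤e y≤e = ≤-trans (x·y≤y y x≤e) y≤e

  e≤⇒ : ∀ {a b} → a ≤ b → e ≤ a ⇒ b
  e≤⇒ {a} {b} p = ⇒-max a b e Q-e (subst (_≤ b) (sym (identityʳ a)) p)

  □-counit : ∀ a → □ A a ≤ a
  □-counit a = subst (_≤ a) (identityˡ (□ A a)) (⇒-le e a)

  □-mono : ∀ {a b} → a ≤ b → □ A a ≤ □ A b
  □-mono {a} {b} p =
    ⇒-max e b (□ A a) (⇒-Q e a) (subst (_≤ b) (sym (identityˡ (□ A a))) (≤-trans (□-counit a) p))

  □^-mono : ∀ n {a b} → a ≤ b → □^ A n a ≤ □^ A n b
  □^-mono zero          p = p
  □^-mono (suc zero)    p = □-mono p
  □^-mono (suc (suc n)) p = ·-mono-≤ (□-mono p) (□^-mono (suc n) p)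

  □^-Q : ∀ n a → Q (□^ A (suc n) a)
  □^-Q zero    a = ⇒-Q e a
  □^-Q (suc n) a = Q-· (⇒-Q e a) (□^-Q n a)

  □^-+ : ∀ m n a → □^ A (suc m + suc n) a ≡ □^ A (suc m) a · □^ A (suc n) a
  □^-+ zero    n a = refl
  □^-+ (suc m) n a = trans (cong (□ A a ·_) (□^-+ m n a)) (sym (assoc _ _ _))

  □^-suc-≤ : ∀ n {a} → a ≤ e → □^ A (suc n) a ≤ □^ A n a
  □^-suc-≤ zero    {a} _   = □-counit a
  □^-suc-≤ (suc n) {a} a≤e = x·y≤y (□^ A (suc n) a) (≤-trans (□-counit a) a≤e)

  □^-antitone : ∀ {m n a} → a ≤ e → m ≤′ n → □^ A n a ≤ □^ A m a
  □^-antitone a≤e ≤′-refl           = ≤-refl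
  □^-antitone a≤e (≤′-step {n} m≤n) = ≤-trans (□^-suc-≤ n a≤e) (□^-antitone a≤e m≤n)

  □^-below : ∀ {m n k h} → k ≤ h → h ≤ e → m ≤ℕ n → □^ A n k ≤ □^ A m h
  □^-below {n = n} k≤h h≤e m≤n = ≤-trans (□^-mono n k≤h) (□^-antitone h≤e (≤⇒≤′ m≤n))

  ⟨⟩-neg : ∀ {S} → _⊆_ A S (Neg A) → _⊆_ A (⟨_⟩ A S) (Neg A)
  ⟨⟩-neg S⁻ _ (gen s)   = S⁻ _ s
  ⟨⟩-neg S⁻ _ unit      = ≤-refl
  ⟨⟩-neg S⁻ _ (mul p q) = ·-neg (⟨⟩-neg S⁻ _ p) (⟨⟩-neg S⁻ _ q)

  module _ {H : Pred A} (H-sub : IsSubalgebra A H) where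
    open IsSubalgebra H-sub

    ⟨⟩-least : ∀ {S} → _⊆_ A S H → _⊆_ A (⟨_⟩ A S) H
    ⟨⟩-least S⊆H _ (gen s)   = S⊆H _ s
    ⟨⟩-least S⊆H _ unit      = e-closed
    ⟨⟩-least S⊆H _ (mul p q) = ·-closed (⟨⟩-least S⊆H _ p) (⟨⟩-least S⊆H _ q)

    □^-closed : ∀ n {a} → H a → H (□^ A n a)
    □^-closed zero          Ha = Ha
    □^-closed (suc zero)    Ha = ⇒-closed e-closed Ha
    □^-closed (suc (suc n)) Ha = ·-closed (⇒-closed e-closed Ha) (□^-closed (suc n) Ha)

  Bounds : Carrier → Carrier → Set
  Bounds k x = k ≤ x × x · k ≤ e

  Bounds-self : ∀ {a} → a ≤ e → Bounds a a
  Bounds-self a≤e = ≤-refl , ·-neg a≤e a≤e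

  Bounds-antitone : ∀ {k k′ x} → k′ ≤ k → Bounds k x → Bounds k′ x
  Bounds-antitone {x = x} k′≤k (k≤x , xk≤e) = ≤-trans k′≤k k≤x , ≤-trans (·-monoʳ-≤ x k′≤k) xk≤e

  Bounds-∧ : ∀ {k x y} → Bounds k x → Bounds k y → Bounds k (x ∧ y)
  Bounds-∧ {k} {x} {y} (k≤x , xk≤e) (k≤y , _) =
    ∧-greatest k≤x k≤y , ≤-trans (·-monoˡ-≤ k (x∧y≤x x y)) xk≤e

  Bounds-∨ : ∀ {k x y} → Bounds k x → Bounds k y → Bounds k (x ∨ y)
  Bounds-∨ {k} {x} {y} (k≤x , xk≤e) (_ , yk≤e) =
    ≤-trans k≤x (x≤x∨y x y) , subst (_≤ e) (sym (distrib x y k)) (∨-least xk≤e yk≤e)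

  Bounds-· : ∀ {k x y} → Bounds k x → Bounds k y → Bounds (k · k) (x · y)
  Bounds-· {k} {x} {y} (k≤x , xk≤e) (k≤y , yk≤e) = ·-mono-≤ k≤x k≤y , xy·kk≤e
    where
    open ≤-Reasoning
    xy·kk≤e : x · y · (k · k) ≤ e
    xy·kk≤e = begin
      x · y · (k · k)   ≡⟨ assoc x y (k · k) ⟩
      x · (y · (k · k)) ≡⟨ cong (x ·_) (trans (sym (assoc y k k)) (cong (_· k) (comm y k))) ⟩
      x · (k · y · k)   ≡⟨ cong (x ·_) (assoc k y k) ⟩
      x · (k · (y · k)) ≡⟨ sym (assoc x k (y · k)) ⟩
      x · k · (y · k)   ≤⟨ ·-neg xk≤e yk≤e ⟩
      e                 ∎

  Bounds-⇒ : ∀ {k x y} → Q k → Bounds k x → Bounds k y → Bounds (k · k) (x ⇒ y)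
  Bounds-⇒ {k} {x} {y} Qk (k≤x , xk≤e) (k≤y , yk≤e) = kk≤x⇒y , x⇒y·kk≤e
    where
    open ≤-Reasoning
    kk≤x⇒y : k · k ≤ x ⇒ y
    kk≤x⇒y = ⇒-max x y (k · k) (Q-· Qk Qk) (begin
      x · (k · k) ≡⟨ sym (assoc x k k) ⟩
      x · k · k   ≤⟨ x·y≤y k xk≤e ⟩
      k           ≤⟨ k≤y ⟩
      y           ∎)
    x⇒y·kk≤e : (x ⇒ y) · (k · k) ≤ e
    x⇒y·kk≤e = begin
      (x ⇒ y) · (k · k) ≡⟨ sym (assoc (x ⇒ y) k k) ⟩
      (x ⇒ y) · k · k   ≡⟨ cong (_· k) (comm (x ⇒ y) k) ⟩
      k · (x ⇒ y) · k   ≤⟨ ·-monoˡ-≤ k (·-monoˡ-≤ (x ⇒ y) k≤x) ⟩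
      x · (x ⇒ y) · k   ≤⟨ ·-monoˡ-≤ k (⇒-le x y) ⟩
      y · k             ≤⟨ yk≤e ⟩
      e                 ∎

  Bounds-convex : ∀ {k a b c} → Bounds k a → Bounds k b → a ≤ c → c ≤ b → Bounds k c
  Bounds-convex {k} (k≤a , _) (_ , bk≤e) a≤c c≤b = ≤-trans k≤a a≤c , ≤-trans (·-monoˡ-≤ k c≤b) bk≤e

  Bounds-strongly : ∀ {k a h} → Bounds k h → a · h ≤ e → e ≤ h ⇒ a → Bounds k a
  Bounds-strongly {k} {a} {h} (k≤h , _) ah≤e e≤h⇒a = ≤-trans k≤h h≤a , ≤-trans (·-monoʳ-≤ a k≤h) ah≤e
    where
    open ≤-Reasoning
    h≤a : h ≤ a
    h≤a = begin
      h           ≡⟨ sym (identityʳ h) ⟩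
      h · e       ≤⟨ ·-monoʳ-≤ h e≤h⇒a ⟩
      h · (h ⇒ a) ≤⟨ ⇒-le h a ⟩
      a           ∎

  Bounds-closed : ∀ {H k x} → IsStronglyConvexSubalgebra A H → H k → Bounds k x → H x
  Bounds-closed H-sc Hk (k≤x , xk≤e) = IsStronglyConvexSubalgebra.strongly H-sc Hk xk≤e (e≤⇒ k≤x)

  BoxBounded : Pred A → Pred A
  BoxBounded S x = Σ Carrier λ h → Σ ℕ λ n → ⟨_⟩ A S h × Bounds (□^ A n h) x

  BoxBounded⊆ : ∀ {S H} → IsStronglyConvexSubalgebra A H → _⊆_ A S H → _⊆_ A (BoxBounded S) H
  BoxBounded⊆ H-sc S⊆H x (h , n , g , b) =
    Bounds-closed H-sc (□^-closed H-sub n (⟨⟩-least H-sub S⊆H h g)) b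
    where
    H-sub = IsConvexSubalgebra.isSubalgebra (IsStronglyConvexSubalgebra.isConvexSubalgebra H-sc)

  module _ {S : Pred A} (S⁻ : _⊆_ A S (Neg A)) where

    BoxBounded-common : ∀ {x y} → BoxBounded S x → BoxBounded S y →
      Σ Carrier λ k → Σ ℕ λ j → ⟨_⟩ A S k × Bounds (□^ A (suc j) k) x × Bounds (□^ A (suc j) k) y
    BoxBounded-common (h₁ , n₁ , g₁ , b₁) (h₂ , n₂ , g₂ , b₂) =
      h₁ · h₂ , n₁ + n₂ , mul g₁ g₂ ,
      Bounds-antitone (□^-below (x·y≤x h₁ h₂≤e) h₁≤e (m≤n⇒m≤1+n (m≤m+n n₁ n₂))) b₁ ,
      Bounds-antitone (□^-below (x·y≤y h₂ h₁≤e) h₂≤e (m≤n⇒m≤1+n (m≤n+m n₂ n₁))) b₂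
      where
      h₁≤e = ⟨⟩-neg S⁻ h₁ g₁
      h₂≤e = ⟨⟩-neg S⁻ h₂ g₂

    BoxBounded-square : ∀ {k z} j → ⟨_⟩ A S k →
      Bounds (□^ A (suc j) k · □^ A (suc j) k) z → BoxBounded S z
    BoxBounded-square {k} {z} j g b =
      k , suc j + suc j , g , subst (λ r → Bounds r z) (sym (□^-+ j j k)) b

    BoxBounded-∧ : ∀ {x y} → BoxBounded S x → BoxBounded S y → BoxBounded S (x ∧ y)
    BoxBounded-∧ p q = let k , j , g , bx , by = BoxBounded-common p q in
      k , suc j , g , Bounds-∧ bx by

    BoxBounded-∨ : ∀ {x y} → BoxBounded S x → BoxBounded S y → BoxBounded S (x ∨ y)
    BoxBounded-∨ p q = let k , j , g , bx , by = BoxBounded-common p q in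
      k , suc j , g , Bounds-∨ bx by

    BoxBounded-· : ∀ {x y} → BoxBounded S x → BoxBounded S y → BoxBounded S (x · y)
    BoxBounded-· p q = let k , j , g , bx , by = BoxBounded-common p q in
      BoxBounded-square j g (Bounds-· bx by)

    BoxBounded-⇒ : ∀ {x y} → BoxBounded S x → BoxBounded S y → BoxBounded S (x ⇒ y)
    BoxBounded-⇒ p q = let k , j , g , bx , by = BoxBounded-common p q in
      BoxBounded-square j g (Bounds-⇒ (□^-Q j k) bx by)

    BoxBounded-convex : ∀ {a b c} → BoxBounded S a → BoxBounded S b → a ≤ c → c ≤ b → BoxBounded S c
    BoxBounded-convex p q a≤c c≤b = let k , j , g , ba , bb = BoxBounded-common p q in
      k , suc j , g , Bounds-convex ba bb a≤c c≤b

    BoxBounded-strongly : ∀ {a h} → BoxBounded S h → a · h ≤ e → e ≤ h ⇒ a → BoxBounded S a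
    BoxBounded-strongly (k , n , g , b) ah≤e e≤h⇒a = k , n , g , Bounds-strongly b ah≤e e≤h⇒a

    BoxBounded-isStronglyConvexSubalgebra : IsStronglyConvexSubalgebra A (BoxBounded S)
    BoxBounded-isStronglyConvexSubalgebra = record
      { isConvexSubalgebra = record
        { isSubalgebra = record
          { ∧-closed = BoxBounded-∧
          ; ∨-closed = BoxBounded-∨
          ; ·-closed = BoxBounded-·
          ; ⇒-closed = BoxBounded-⇒
          ; e-closed = e , 0 , unit , Bounds-self ≤-refl
          }
        ; convex = BoxBounded-convex
        }
      ; strongly = BoxBounded-strongly
      }

    S⊆BoxBounded : _⊆_ A S (BoxBounded S)
    S⊆BoxBounded s Ss = s , 0 , gen Ss , Bounds-self (S⁻ s Ss)

open SRLMonoid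

lemma4p3 : (A : SRLMonoid) (S : Pred A) → _⊆_ A S (Neg A) →
    ∀ (x : Carrier A) →
      C[_] A S x ⇔
        (Σ (Carrier A) λ h → Σ ℕ λ n →
          ⟨_⟩ A S h × (_≤_ A (□^ A n h) x × _≤_ A (_·_ A x (□^ A n h)) (e A)))
lemma4p3 A S S⁻ x = mk⇔
  (λ x∈C[S] → x∈C[S] (BoxBounded A S) (BoxBounded-isStronglyConvexSubalgebra A S⁻) (S⊆BoxBounded A S⁻))
  (λ x∈BoxBounded H H-sc S⊆H → BoxBounded⊆ A H-sc S⊆H x x∈BoxBounded)
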